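{- Let $X$ be a simple graph on $n$ vertices with finite girth $g(X)$. Then $g(\mathsf{FS}(X,\text{Star}_n)) \leq g(X)\cdot(g(X)-1)$.
   Context: $g$ denotes girth (length of a shortest cycle). $\text{Star}_n$ is the star graph on $n$ vertices. $\mathsf{FS}(X,Y)$ has as vertices all bijections $\sigma: V(X)\to V(Y)$, with $\sigma,\sigma'$ adjacent iff there is an edge $\{a,b\}\in E(X)$ with $\{\sigma(a),\sigma(b)\}\in E(Y)$, $\sigma'(a)=\sigma(b)$, $\sigma'(b)=\sigma(a)$ and $\sigma'=\sigma$ elsewhere. -}

module Defs where

open import Level using (Level; 0ℓ)
open import Data.Nat using (ℕ; zero; suc; _≤_; _<_; _∸_; _*_)
open import Data.Fin using (Fin; toℕ)
open import Data.Product using (Σ; _×_; ∃; ∃-syntax)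
open import Data.Sum using (_⊎_)
open import Relation.Nullary using (¬_)
open import Relation.Binary.PropositionalEquality using (_≡_; _≢_)
open import Function.Definitions using (Bijective)

-- A graph: vertex type, adjacency relation, and the equality of vertices
-- (needed because vertices of FS are functions, compared pointwise).
record Graph : Set₁ where
  field
    V   : Set
    Adj : V → V → Set
    _≈_ : V → V → Set

record SimpleGraph (n : ℕ) : Set₁ where
  field
    Adj   : Fin n → Fin n → Set
    sym   : ∀ {a b} → Adj a b → Adj b a
    irrefl : ∀ {a} → ¬ Adj a a

toGraph : ∀ {n} → SimpleGraph n → Graph
toGraph {n} X = record { V = Fin n ; Adj = SimpleGraph.Adj X ; _≈_ = _≡_ }

HasCycleOfLength : Graph → ℕ → Set
HasCycleOfLength G k =
  3 ≤ k × Σ (ℕ → V) λ f →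
    (∀ i → suc i < k → Adj (f i) (f (suc i))) ×
    Adj (f (k ∸ 1)) (f 0) ×
    (∀ i j → i < j → j < k → ¬ (f i ≈ f j))
  where open Graph G

HasGirth : Graph → ℕ → Set
HasGirth G g = HasCycleOfLength G g × (∀ k → k < g → ¬ HasCycleOfLength G k)

GirthAtMost : Graph → ℕ → Set
GirthAtMost G m = ∃[ k ] (k ≤ m × HasCycleOfLength G k)

Star : (n : ℕ) → SimpleGraph n
Star n = record
  { Adj = λ a b → (toℕ a ≡ 0 × toℕ b ≢ 0) ⊎ (toℕ a ≢ 0 × toℕ b ≡ 0)
  ; sym = λ { (Data.Sum.inj₁ (p , q)) → Data.Sum.inj₂ (q , p)
            ; (Data.Sum.inj₂ (p , q)) → Data.Sum.inj₁ (q , p) }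
  ; irrefl = λ { (Data.Sum.inj₁ (p , q)) → q p ; (Data.Sum.inj₂ (p , q)) → p q }
  }
  where open Data.Product using (_,_)

FS : ∀ {n} → SimpleGraph n → SimpleGraph n → Graph
FS {n} X Y = record
  { V = Σ (Fin n → Fin n) (Bijective {A = Fin n} {B = Fin n} _≡_ _≡_)
  ; Adj = λ σ σ' →
      ∃[ a ] ∃[ b ] (X.Adj a b × Y.Adj (fst σ a) (fst σ b) ×
        fst σ' a ≡ fst σ b × fst σ' b ≡ fst σ a ×
        (∀ c → c ≢ a → c ≢ b → fst σ' c ≡ fst σ c))
  ; _≈_ = λ σ σ' → ∀ x → fst σ x ≡ fst σ' x
  }
  where
    module X = SimpleGraph X
    module Y = SimpleGraph Y
    open Data.Product renaming (proj₁ to fst)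

-- In the star only the centre 0 is adjacent to anything, so σ ~ σ ∘ (a b) in
-- FS(X, Star_n) exactly when {a, b} is an edge of X and σ sends a or b to 0.
-- Call σ⁻¹(0) the hole and the other values tokens: a step slides a token into
-- the hole along an edge of X. Given a g-cycle c₀ … c_{g-1} of X, start with the
-- hole at c₀ and push it around the cycle. Each full turn of g slides rotates the
-- g - 1 tokens on the cycle by one place, so after g - 1 turns everything is
-- back, and the g(g - 1) configurations met on the way are pairwise distinct
-- (hole position and rotation can be read off).

module Submission where

open import Defs
open import Data.Nat using (ℕ; zero; suc; _+_; _*_; _∸_; _<_; z≤n; s≤s; z<s; s≤s⁻¹; NonZero)
open import Data.Nat.Properties renaming (_≟_ to _≟ℕ_)
open import Data.Nat.DivMod
open import Data.Fin as Fin using (Fin; toℕ)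
open import Data.Fin.Properties using (_≟_; toℕ-injective)
import Data.Fin.Permutation as Permutation
open import Data.Fin.Permutation.Components using (transpose)
open import Data.Product using (Σ; _×_; _,_; proj₁; proj₂)
open import Data.Sum using (inj₁; inj₂)
open import Function using (_∘_)
open import Function.Bundles using (Bijection)
open import Function.Definitions using (Bijective)
open import Function.Properties.Inverse using (↔⇒⤖)
import Function.Construct.Composition as Compose
open import Relation.Nullary using (¬_; Dec; yes; no; contradiction)
open import Relation.Nullary.Decidable using (dec-true; dec-false)
open import Relation.Binary using (tri<; tri≈; tri>)
open import Relation.Binary.PropositionalEquality

module _ {n : ℕ} (i j : Fin n) where

  transpose-matchˡ : transpose i j i ≡ j
  transpose-matchˡ rewrite dec-true (i ≟ i) refl = refl

  transpose-matchʳ : transpose i j j ≡ i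
  transpose-matchʳ with j ≟ i
  ... | yes j≡i = j≡i
  ... | no _ rewrite dec-true (j ≟ j) refl = refl

  transpose-other : ∀ {k} → k ≢ i → k ≢ j → transpose i j k ≡ k
  transpose-other {k} k≢i k≢j rewrite dec-false (k ≟ i) k≢i | dec-false (k ≟ j) k≢j = refl

  transpose-bijective : Bijective _≡_ _≡_ (transpose i j)
  transpose-bijective = Bijection.bijective (↔⇒⤖ (Permutation.transpose i j))

swapAt : ∀ {n} → Σ (Fin n → Fin n) (Bijective _≡_ _≡_) → Fin n → Fin n →
         Σ (Fin n → Fin n) (Bijective _≡_ _≡_)
swapAt (σ , σ-bij) a b = σ ∘ transpose a b , Compose.bijective _≡_ _≡_ _≡_ (transpose-bijective a b) σ-bij

module _ {n : ℕ} (X Y : SimpleGraph n) where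
  open Graph (FS X Y)

  FS-Adj-respʳ : ∀ {σ τ τ′} → Adj σ τ → τ ≈ τ′ → Adj σ τ′
  FS-Adj-respʳ (a , b , a~b , σa~σb , τa , τb , τc) τ≈τ′ =
    a , b , a~b , σa~σb , trans (sym (τ≈τ′ a)) τa , trans (sym (τ≈τ′ b)) τb ,
    λ c c≢a c≢b → trans (sym (τ≈τ′ c)) (τc c c≢a c≢b)

module _ {n : ℕ} (X : SimpleGraph (suc n)) where
  open Graph (FS X (Star (suc n)))

  FS-Star-slide : (σ : V) {a b : Fin (suc n)} → SimpleGraph.Adj X a b →
    proj₁ σ a ≡ Fin.zero → proj₁ σ b ≢ Fin.zero →
    Adj σ (swapAt σ a b)
  FS-Star-slide (σ , _) {a} {b} a~b σa≡0 σb≢0 =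
    a , b , a~b , inj₁ (cong toℕ σa≡0 , σb≢0 ∘ toℕ-injective) ,
    cong σ (transpose-matchˡ a b) , cong σ (transpose-matchʳ a b) ,
    λ c c≢a c≢b → cong σ (transpose-other a b c≢a c≢b)

divMod-unique : ∀ {d t q r} .{{_ : NonZero d}} → r < d → t ≡ r + q * d → t / d ≡ q × t % d ≡ r
divMod-unique {d} {q = q} {r} r<d refl = quotient , remainder
  where
  open ≤-Reasoning
  r%d+q*d%d<d : r % d + q * d % d < d
  r%d+q*d%d<d = begin-strict
    r % d + q * d % d ≡⟨ cong₂ _+_ (m<n⇒m%n≡m r<d) (m*n%n≡0 q d) ⟩
    r + 0             ≡⟨ +-identityʳ r ⟩
    r                 <⟨ r<d ⟩
    d                 ∎
  quotient : (r + q * d) / d ≡ q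
  quotient = begin-equality
    (r + q * d) / d   ≡⟨ +-distrib-/ r (q * d) r%d+q*d%d<d ⟩
    r / d + q * d / d ≡⟨ cong₂ _+_ (m<n⇒m/n≡0 r<d) (m*n/n≡m q d) ⟩
    q                 ∎
  remainder : (r + q * d) % d ≡ r
  remainder = trans ([m+kn]%n≡m%n r q d) (m<n⇒m%n≡m r<d)

module Rotation (k : ℕ) where

  m g : ℕ
  m = suc k
  g = suc m

  -- One tick of the walk: q counts completed turns, the hole moves from c r to c r′.
  data Step : ℕ → ℕ → ℕ → ℕ → Set where
    advance : ∀ {q r} → suc r < g → Step q r q (suc r)
    wrap    : ∀ {q} → Step q m (suc q) 0

  clock-advance : ∀ t → suc (t % g) < g → suc t / g ≡ t / g × suc t % g ≡ suc (t % g)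
  clock-advance t hole+1<g = divMod-unique hole+1<g (cong suc (m≡m%n+[m/n]*n t g))

  clock-wrap : ∀ t → suc (t % g) ≡ g → suc t / g ≡ suc (t / g) × suc t % g ≡ 0
  clock-wrap t hole+1≡g = divMod-unique z<s (begin
    suc t                   ≡⟨ cong suc (m≡m%n+[m/n]*n t g) ⟩
    suc (t % g) + t / g * g ≡⟨ cong (_+ t / g * g) hole+1≡g ⟩
    g + t / g * g           ∎)
    where open ≡-Reasoning

  clock-step : ∀ t → Step (t / g) (t % g) (suc t / g) (suc t % g)
  clock-step t with m≤n⇒m<n∨m≡n (m%n<n t g)
  ... | inj₁ hole+1<g with suc t / g | suc t % g | clock-advance t hole+1<g
  ...   | _ | _ | refl , refl = advance hole+1<g
  clock-step t | inj₂ hole+1≡g with t % g | hole+1≡g | suc t / g | suc t % g | clock-wrap t hole+1≡g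
  ...   | _ | refl | _ | _ | refl , refl = wrap

  private variable q q′ r r′ i : ℕ

  -- The token at c i after q turns, with the hole at c r, is the one that started
  -- at c (label q r i): the tokens keep their cyclic order, shifted by q.
  label : ℕ → ℕ → ℕ → ℕ
  label q r i with <-cmp i r
  ... | tri< _ _ _ = suc ((i + q) % m)
  ... | tri≈ _ _ _ = 0
  ... | tri> _ _ _ = suc ((i ∸ 1 + q) % m)

  label-< : ∀ q → i < r → label q r i ≡ suc ((i + q) % m)
  label-< {i} {r} q i<r with <-cmp i r
  ... | tri< _ _ _   = refl
  ... | tri≈ i≮r _ _ = contradiction i<r i≮r
  ... | tri> i≮r _ _ = contradiction i<r i≮r

  label-hole : ∀ q r → label q r r ≡ 0
  label-hole q r with <-cmp r r
  ... | tri< _ r≢r _ = contradiction refl r≢r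
  ... | tri≈ _ _ _   = refl
  ... | tri> _ r≢r _ = contradiction refl r≢r

  label-> : ∀ q → r < i → label q r i ≡ suc ((i ∸ 1 + q) % m)
  label-> {r} {i} q r<i with <-cmp i r
  ... | tri< _ _ r≮i = contradiction r<i r≮i
  ... | tri≈ _ _ r≮i = contradiction r<i r≮i
  ... | tri> _ _ _   = refl

  label<g : ∀ q r i → label q r i < g
  label<g q r i with <-cmp i r
  ... | tri< _ _ _ = s≤s (m%n<n (i + q) m)
  ... | tri≈ _ _ _ = z<s
  ... | tri> _ _ _ = s≤s (m%n<n (i ∸ 1 + q) m)

  label≡0⇒hole : label q r i ≡ 0 → i ≡ r
  label≡0⇒hole {q} {r} {i} with <-cmp i r
  ... | tri< _ _ _   = λ ()
  ... | tri≈ _ i≡r _ = λ _ → i≡r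
  ... | tri> _ _ _   = λ ()

  label-initial : i < g → label 0 0 i ≡ i
  label-initial {zero}  _   = label-hole 0 0
  label-initial {suc i} i<g = begin
    label 0 0 (suc i) ≡⟨ label-> {i = suc i} 0 z<s ⟩
    suc ((i + 0) % m) ≡⟨ cong (λ j → suc (j % m)) (+-identityʳ i) ⟩
    suc (i % m)       ≡⟨ cong suc (m<n⇒m%n≡m (s≤s⁻¹ i<g)) ⟩
    suc i             ∎
    where open ≡-Reasoning

  label-full-turn : i < g → label m 0 i ≡ i
  label-full-turn {zero}  _   = label-hole m 0
  label-full-turn {suc i} i<g = begin
    label m 0 (suc i) ≡⟨ label-> {i = suc i} m z<s ⟩
    suc ((i + m) % m) ≡⟨ cong suc ([m+n]%n≡m%n i m) ⟩
    suc (i % m)       ≡⟨ cong suc (m<n⇒m%n≡m (s≤s⁻¹ i<g)) ⟩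
    suc i             ∎
    where open ≡-Reasoning

  step-moves : Step q r q′ r′ → r′ ≢ r
  step-moves (advance _) = 1+n≢n
  step-moves wrap        = λ ()

  step-target<g : Step q r q′ r′ → r′ < g
  step-target<g (advance r+1<g) = r+1<g
  step-target<g wrap            = z<s

  label-step-swapped : Step q r q′ r′ → label q′ r′ r ≡ label q r r′
  label-step-swapped {q} {r} (advance _) = trans (label-< q (n<1+n r)) (sym (label-> q (n<1+n r)))
  label-step-swapped {q} wrap = begin
    label (suc q) 0 m     ≡⟨ label-> {i = m} (suc q) z<s ⟩
    suc ((k + suc q) % m) ≡⟨ cong (λ j → suc (j % m)) (trans (+-comm k (suc q)) (sym (+-suc q k))) ⟩
    suc ((q + m) % m)     ≡⟨ cong suc ([m+n]%n≡m%n q m) ⟩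
    suc (q % m)           ≡⟨ sym (label-< {r = m} q z<s) ⟩
    label q m 0           ∎
    where open ≡-Reasoning

  label-step-other : Step q r q′ r′ → i < g → i ≢ r → i ≢ r′ → label q′ r′ i ≡ label q r i
  label-step-other {q} {r} {i = i} (advance _) _ i≢r i≢r+1 with ≤-<-connex i r
  ... | inj₁ i≤r = trans (label-< q (m<n⇒m<1+n i<r)) (sym (label-< q i<r))
    where
    i<r : i < r
    i<r = ≤∧≢⇒< i≤r i≢r
  ... | inj₂ r<i = trans (label-> q (≤∧≢⇒< r<i (≢-sym i≢r+1))) (sym (label-> q r<i))
  label-step-other {i = zero}  wrap _ _ i≢0 = contradiction refl i≢0
  label-step-other {q} {i = suc i} wrap i<g i≢m _ = begin
    label (suc q) 0 (suc i) ≡⟨ label-> {i = suc i} (suc q) z<s ⟩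
    suc ((i + suc q) % m)   ≡⟨ cong (λ j → suc (j % m)) (+-suc i q) ⟩
    suc ((suc i + q) % m)   ≡⟨ sym (label-< q (≤∧≢⇒< (s≤s⁻¹ i<g) i≢m)) ⟩
    label q m (suc i)       ∎
    where open ≡-Reasoning

  probe : ℕ → ℕ
  probe zero    = 1
  probe (suc _) = 0

  probe<g : ∀ r → probe r < g
  probe<g zero    = s≤s z<s
  probe<g (suc _) = z<s

  label-probe : ∀ r → q < m → label q r (probe r) ≡ suc q
  label-probe {q} zero    q<m = trans (label-> {i = 1} q z<s) (cong suc (m<n⇒m%n≡m q<m))
  label-probe {q} (suc r) q<m = trans (label-< {r = suc r} q z<s) (cong suc (m<n⇒m%n≡m q<m))

  label-injective : q < m → q′ < m → r < g →
    (∀ i → i < g → label q r i ≡ label q′ r′ i) → q ≡ q′ × r ≡ r′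
  label-injective {q} {q′} {r} {r′} q<m q′<m r<g same = q≡q′ , r≡r′
    where
    r≡r′ : r ≡ r′
    r≡r′ = label≡0⇒hole (trans (sym (same r r<g)) (label-hole q r))
    q≡q′ : q ≡ q′
    q≡q′ = suc-injective (begin
      suc q                  ≡⟨ sym (label-probe r q<m) ⟩
      label q r (probe r)    ≡⟨ same (probe r) (probe<g r) ⟩
      label q′ r′ (probe r)  ≡⟨ cong (λ h → label q′ h (probe r)) (sym r≡r′) ⟩
      label q′ r (probe r)   ≡⟨ label-probe r q′<m ⟩
      suc q′                 ∎)
      where open ≡-Reasoning

module HoleAroundCycle {n : ℕ} (X : SimpleGraph (suc n)) (k : ℕ) (c : ℕ → Fin (suc n))
  (c-adj : ∀ i → suc i < 3 + k → SimpleGraph.Adj X (c i) (c (suc i)))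
  (c-close : SimpleGraph.Adj X (c (2 + k)) (c 0))
  (c-distinct : ∀ i j → i < j → j < 3 + k → ¬ c i ≡ c j) where

  open Rotation (suc k)
  open Graph (FS X (Star (suc n))) using (_≈_) renaming (V to Config; Adj to _⟶_)

  private variable q q′ r r′ i j : ℕ

  c-injective : i < g → j < g → c i ≡ c j → i ≡ j
  c-injective {i} {j} i<g j<g ci≡cj with <-cmp i j
  ... | tri< i<j _ _ = contradiction ci≡cj (c-distinct i j i<j j<g)
  ... | tri≈ _ i≡j _ = i≡j
  ... | tri> _ _ j<i = contradiction (sym ci≡cj) (c-distinct j i j<i i<g)

  c-preserves-≢ : i < g → j < g → i ≢ j → c i ≢ c j
  c-preserves-≢ i<g j<g i≢j = i≢j ∘ c-injective i<g j<g

  σ₀ : Fin (suc n) → Fin (suc n)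
  σ₀ = transpose (c 0) Fin.zero

  σ₀∘c-injective : i < g → j < g → σ₀ (c i) ≡ σ₀ (c j) → i ≡ j
  σ₀∘c-injective i<g j<g = c-injective i<g j<g ∘ proj₁ (transpose-bijective (c 0) Fin.zero)

  σ₀∘c≡0⇒≡0 : i < g → σ₀ (c i) ≡ Fin.zero → i ≡ 0
  σ₀∘c≡0⇒≡0 i<g σ₀ci≡0 = σ₀∘c-injective i<g z<s (trans σ₀ci≡0 (sym (transpose-matchˡ (c 0) Fin.zero)))

  Arranged : (Fin (suc n) → Fin (suc n)) → ℕ → ℕ → Set
  Arranged s q r = ∀ i → i < g → s (c i) ≡ σ₀ (c (label q r i))

  step-edge : Step q r q′ r′ → SimpleGraph.Adj X (c r) (c r′)
  step-edge {r = r} (advance r+1<g) = c-adj r r+1<g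
  step-edge wrap                    = c-close

  arranged-step : ∀ {s} → Step q r q′ r′ → r < g → Arranged s q r →
    Arranged (s ∘ transpose (c r) (c r′)) q′ r′
  arranged-step {q} {r} {q′} {r′} {s} st r<g arranged i i<g = by-position (i ≟ℕ r) (i ≟ℕ r′)
    where
    open ≡-Reasoning
    by-position : Dec (i ≡ r) → Dec (i ≡ r′) →
      s (transpose (c r) (c r′) (c i)) ≡ σ₀ (c (label q′ r′ i))
    by-position (yes refl) _ = begin
      s (transpose (c i) (c r′) (c i)) ≡⟨ cong s (transpose-matchˡ (c i) (c r′)) ⟩
      s (c r′)                         ≡⟨ arranged r′ (step-target<g st) ⟩
      σ₀ (c (label q i r′))            ≡⟨ cong (σ₀ ∘ c) (sym (label-step-swapped st)) ⟩
      σ₀ (c (label q′ r′ i))           ∎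
    by-position (no _) (yes refl) = begin
      s (transpose (c r) (c i) (c i)) ≡⟨ cong s (transpose-matchʳ (c r) (c i)) ⟩
      s (c r)                         ≡⟨ arranged r r<g ⟩
      σ₀ (c (label q r r))            ≡⟨ cong (σ₀ ∘ c) (trans (label-hole q r) (sym (label-hole q′ i))) ⟩
      σ₀ (c (label q′ i i))           ∎
    by-position (no i≢r) (no i≢r′) = begin
      s (transpose (c r) (c r′) (c i)) ≡⟨ cong s (transpose-other (c r) (c r′) ci≢cr ci≢cr′) ⟩
      s (c i)                          ≡⟨ arranged i i<g ⟩
      σ₀ (c (label q r i))             ≡⟨ cong (σ₀ ∘ c) (sym (label-step-other st i<g i≢r i≢r′)) ⟩
      σ₀ (c (label q′ r′ i))           ∎
      where
      ci≢cr : c i ≢ c r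
      ci≢cr = c-preserves-≢ i<g r<g i≢r
      ci≢cr′ : c i ≢ c r′
      ci≢cr′ = c-preserves-≢ i<g (step-target<g st) i≢r′

  config : ℕ → Config
  config zero    = σ₀ , transpose-bijective (c 0) Fin.zero
  config (suc t) = swapAt (config t) (c (t % g)) (c (suc t % g))

  arranged : ∀ t → Arranged (proj₁ (config t)) (t / g) (t % g)
  arranged zero    i i<g = cong (σ₀ ∘ c) (sym (label-initial i<g))
  arranged (suc t) = arranged-step {s = proj₁ (config t)} (clock-step t) (m%n<n t g) (arranged t)

  config-off-cycle : ∀ t {x} → (∀ i → i < g → x ≢ c i) → proj₁ (config t) x ≡ σ₀ x
  config-off-cycle zero    _ = refl
  config-off-cycle (suc t) {x} off =
    trans (cong (proj₁ (config t)) (transpose-other (c (t % g)) (c (suc t % g))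
                                     (off (t % g) (m%n<n t g)) (off (suc t % g) (m%n<n (suc t) g))))
          (config-off-cycle t off)

  hole-empty : ∀ t → proj₁ (config t) (c (t % g)) ≡ Fin.zero
  hole-empty t = begin
    proj₁ (config t) (c (t % g))          ≡⟨ arranged t (t % g) (m%n<n t g) ⟩
    σ₀ (c (label (t / g) (t % g) (t % g))) ≡⟨ cong (σ₀ ∘ c) (label-hole (t / g) (t % g)) ⟩
    σ₀ (c 0)                              ≡⟨ transpose-matchˡ (c 0) Fin.zero ⟩
    Fin.zero                              ∎
    where open ≡-Reasoning

  non-hole-occupied : ∀ t → i < g → i ≢ t % g → proj₁ (config t) (c i) ≢ Fin.zero
  non-hole-occupied t i<g i≢hole empty = i≢hole (label≡0⇒hole (σ₀∘c≡0⇒≡0 (label<g _ _ _)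
    (trans (sym (arranged t _ i<g)) empty)))

  config-step : ∀ t → config t ⟶ config (suc t)
  config-step t = FS-Star-slide X (config t) (step-edge (clock-step t)) (hole-empty t)
    (non-hole-occupied t (m%n<n (suc t) g) (step-moves (clock-step t)))

  K : ℕ
  K = g * m

  K-divMod : K / g ≡ m × K % g ≡ 0
  K-divMod = divMod-unique {d = g} z<s (*-comm g m)

  round<m : ∀ t → t < K → t / g < m
  round<m t t<K = m<n*o⇒m/o<n (subst (t <_) (*-comm g m) t<K)

  config-injective : i < K → j < K → config i ≈ config j → i ≡ j
  config-injective {i} {j} i<K j<K i≈j = begin
    i                 ≡⟨ m≡m%n+[m/n]*n i g ⟩
    i % g + i / g * g ≡⟨ cong₂ (λ q r → r + q * g) (proj₁ same-clock) (proj₂ same-clock) ⟩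
    j % g + j / g * g ≡⟨ sym (m≡m%n+[m/n]*n j g) ⟩
    j                 ∎
    where
    open ≡-Reasoning
    same-labels : ∀ p → p < g → label (i / g) (i % g) p ≡ label (j / g) (j % g) p
    same-labels p p<g = σ₀∘c-injective (label<g _ _ _) (label<g _ _ _)
      (trans (sym (arranged i p p<g)) (trans (i≈j (c p)) (arranged j p p<g)))
    same-clock : i / g ≡ j / g × i % g ≡ j % g
    same-clock = label-injective (round<m i i<K) (round<m j j<K) (m%n<n i g) same-labels

  config-returns : config K ≈ config 0
  config-returns x with anyUpTo? (λ i → c i Fin.≟ x) g
  ... | yes (i , i<g , refl) = begin
    proj₁ (config K) (c i)           ≡⟨ arranged K i i<g ⟩
    σ₀ (c (label (K / g) (K % g) i)) ≡⟨ cong₂ (λ q r → σ₀ (c (label q r i))) (proj₁ K-divMod) (proj₂ K-divMod) ⟩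
    σ₀ (c (label m 0 i))             ≡⟨ cong (σ₀ ∘ c) (label-full-turn i<g) ⟩
    σ₀ (c i)                         ∎
    where open ≡-Reasoning
  ... | no not-on-cycle = config-off-cycle K (λ i i<g x≡ci → not-on-cycle (i , i<g , sym x≡ci))

  FS-cycle : HasCycleOfLength (FS X (Star (suc n))) K
  FS-cycle = ≤-trans (s≤s (s≤s (s≤s z≤n))) (m≤m*n g m) , config , (λ t _ → config-step t) ,
    FS-Adj-respʳ X (Star (suc n)) {config (K ∸ 1)} {config K} {config 0} (config-step (K ∸ 1)) config-returns ,
    λ i j i<j j<K i≈j → <⇒≢ i<j (config-injective (<-trans i<j j<K) j<K i≈j)

FS-Star-cycle : ∀ {n g} (X : SimpleGraph n) → HasCycleOfLength (toGraph X) g →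
  HasCycleOfLength (FS X (Star n)) (g * (g ∸ 1))
FS-Star-cycle {zero} _ (_ , c , _) with c 0
... | ()
FS-Star-cycle {suc n} X (s≤s (s≤s (s≤s (z≤n {k}))) , c , c-adj , c-close , c-distinct) =
  HoleAroundCycle.FS-cycle X k c c-adj c-close c-distinct

proposition4p5 : (n : ℕ) (X : SimpleGraph n) (g : ℕ) →
    HasGirth (toGraph X) g →
    GirthAtMost (FS X (Star n)) (g * (g ∸ 1))
proposition4p5 n X g (cycle , _) = g * (g ∸ 1) , ≤-refl , FS-Star-cycle X cycle
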